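{- Every star graph is a hook-graph: for any $n\ge1$ and any $i\in[n]$, the simple graph on $[n]$ with edge set $\{\{i,j\}: j\in[n],\ j\ne i\}$ is a hook-graph.
   Context: For a simple graph $G$ on $[n]$ with $r$ edges, the Burge array $\mathcal{A}_G=\begin{bmatrix} a_1&\cdots&a_r\\ b_1&\cdots&b_r\end{bmatrix}$ is the unique two-line array whose columns are the edges of $G$, each edge $\{a,b\}$ with $a>b$ written once as a column with top $a$ and bottom $b$, ordered so that $a_1\le\cdots\le a_r$ and $b_k>b_{k+1}$ whenever $a_k=a_{k+1}$. Schensted row insertion $T\leftarrow x$: if $x$ is $\ge$ every entry of row $1$, append $x$ to row $1$; otherwise $x$ replaces the leftmost entry $y>x$ of row $1$, and $y$ is inserted into row $2$ in the same way, etc. Burge correspondence: $T_0=\emptyset$; for $k=1,\dots,r$, form $T_{k-1}\leftarrow b_k$, creating a new cell $(s,t)$ (row $s$, column $t$), then place $a_k$ in cell $(t+1,s)$ if $s\le t$ and in cell $(t,s-1)$ if $s>t$, giving $T_k$. $T_G:=T_r$; the shape of $G$ is the shape of $T_G$. A partition is a hook if its Young diagram has no $2\times2$ square; $G$ is a hook-graph if its shape is a hook. -}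

module Defs where

open import Data.Nat using (ℕ; zero; suc; _+_; _≤_; _<_; _<ᵇ_; _≡ᵇ_)
open import Data.Bool using (Bool; true; false; if_then_else_; _∧_; _∨_; not)
open import Data.List using (List; []; _∷_; length; _++_; map; concatMap)
open import Data.Product using (_×_; _,_; proj₁; ∃-syntax)
open import Data.Maybe using (Maybe; just; nothing)
open import Relation.Binary.PropositionalEquality using (_≡_; refl)
open import Relation.Nullary using (¬_)

-- Simple graphs on [n] = {1,…,n}: a symmetric, irreflexive Boolean
-- adjacency relation (only its values on [n] × [n] are ever used).

record SimpleGraph (n : ℕ) : Set where
  field
    adj    : ℕ → ℕ → Bool
    sym    : ∀ x y → adj x y ≡ adj y x
    irrefl : ∀ x → adj x x ≡ false
open SimpleGraph public

-- Burge array: list of columns (a , b) with a > b, ordered by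
-- increasing a, and for equal a by decreasing b.

downTo1 : ℕ → List ℕ
downTo1 zero    = []
downTo1 (suc k) = suc k ∷ downTo1 k

oneTo : ℕ → List ℕ
oneTo zero    = []
oneTo (suc k) = oneTo k ++ (suc k ∷ [])

filterB : {A : Set} → (A → Bool) → List A → List A
filterB p []       = []
filterB p (x ∷ xs) = if p x then x ∷ filterB p xs else filterB p xs

columnsAt : ∀ {n} → SimpleGraph n → ℕ → List (ℕ × ℕ)
columnsAt G zero    = []
columnsAt G (suc k) =
  map (λ b → (suc k , b)) (filterB (adj G (suc k)) (downTo1 k))

burgeArray : ∀ {n} → SimpleGraph n → List (ℕ × ℕ)
burgeArray {n} G = concatMap (columnsAt G) (oneTo n)

-- Tableaux as lists of rows (row 1 first), entries left to right.

Tableau : Set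
Tableau = List (List ℕ)

bumpRow : ℕ → List ℕ → Maybe ℕ × List ℕ
bumpRow x []       = nothing , x ∷ []
bumpRow x (y ∷ ys) with x <ᵇ y
... | true  = just y , x ∷ ys
... | false with bumpRow x ys
...   | (m , ys') = m , y ∷ ys'

-- insertRows x T s : Schensted row insertion of x into T, whose first
-- row is row number s; returns the new tableau and the new cell (row, col),
-- 1-indexed.
insertRows : ℕ → Tableau → ℕ → Tableau × ℕ × ℕ
insertRows x []       s = (x ∷ []) ∷ [] , s , 1
insertRows x (r ∷ rs) s with bumpRow x r
... | (nothing , r') = r' ∷ rs , s , length r'
... | (just y  , r') with insertRows y rs (suc s)
...   | (rs' , s' , t') = r' ∷ rs' , s' , t'

rowInsert : ℕ → Tableau → Tableau × ℕ × ℕ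
rowInsert x T = insertRows x T 1

-- place a into a new cell in row r (1-indexed), i.e. at the end of row r
-- (rows are created if necessary).  In the Burge correspondence the target
-- cell is always the next free cell of its row.
placeInRow : ℕ → ℕ → Tableau → Tableau
placeInRow a zero          T        = T
placeInRow a (suc zero)    []       = (a ∷ []) ∷ []
placeInRow a (suc zero)    (r ∷ rs) = (r ++ (a ∷ [])) ∷ rs
placeInRow a (suc (suc k)) []       = [] ∷ placeInRow a (suc k) []
placeInRow a (suc (suc k)) (r ∷ rs) = r ∷ placeInRow a (suc k) rs

burgeStep : Tableau → ℕ × ℕ → Tableau
burgeStep T (a , b) with rowInsert b T
... | (T' , s , t) =
  if (t <ᵇ s)
    then placeInRow a t T'          -- s > t : cell (t , s-1)
    else placeInRow a (suc t) T'    -- s ≤ t : cell (t+1 , s)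

burgeRun : Tableau → List (ℕ × ℕ) → Tableau
burgeRun T []       = T
burgeRun T (c ∷ cs) = burgeRun (burgeStep T c) cs

tableauOf : ∀ {n} → SimpleGraph n → Tableau
tableauOf G = burgeRun [] (burgeArray G)

Partition : Set
Partition = List ℕ

shapeOf : Tableau → Partition
shapeOf = map length

graphShape : ∀ {n} → SimpleGraph n → Partition
graphShape G = shapeOf (tableauOf G)

-- length of row r (1-indexed), 0 if absent
rowLen : Partition → ℕ → ℕ
rowLen []       _             = 0
rowLen (l ∷ ls) zero          = 0
rowLen (l ∷ ls) (suc zero)    = l
rowLen (l ∷ ls) (suc (suc r)) = rowLen ls (suc r)

InDiagram : Partition → ℕ → ℕ → Set
InDiagram λp r c = 1 ≤ r × 1 ≤ c × c ≤ rowLen λp r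

IsHook : Partition → Set
IsHook λp = ∀ r c → ¬ (InDiagram λp r c × InDiagram λp (suc r) c
                       × InDiagram λp r (suc c) × InDiagram λp (suc r) (suc c))

IsHookGraph : ∀ {n} → SimpleGraph n → Set
IsHookGraph G = IsHook (graphShape G)

starAdj : ℕ → ℕ → ℕ → Bool
starAdj i x y = ((x ≡ᵇ i) ∧ not (y ≡ᵇ i)) ∨ ((y ≡ᵇ i) ∧ not (x ≡ᵇ i))

starAdj-sym : ∀ i x y → starAdj i x y ≡ starAdj i y x
starAdj-sym i x y with x ≡ᵇ i | y ≡ᵇ i
... | true  | true  = refl
... | true  | false = refl
... | false | true  = refl
... | false | false = refl

starAdj-irrefl : ∀ i x → starAdj i x x ≡ false
starAdj-irrefl i x with x ≡ᵇ i
... | true  = refl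
... | false = refl

starGraph : (n i : ℕ) → SimpleGraph n
starGraph n i = record { adj = starAdj i ; sym = starAdj-sym i ; irrefl = starAdj-irrefl i }

-- In the Burge array of the star centred at i the columns are (i, i−1), …, (i, 1),
-- followed by (a, i) for a = i+1, …, n.  Inserting i−1, …, 1 in turn pushes the
-- whole first column down one row, so the new cell lies at the bottom of column 1
-- and its partner i is appended to row 1.  Afterwards the first row has all entries
-- ≤ i, so each later i is appended to it and its partner a starts a new row of
-- length one.  The tableau is therefore always one row on top of a column of
-- single cells: a hook.
module Submission where

open import Defs hiding (sym)
open import Data.Nat using (ℕ; zero; suc; _+_; _≤_; _<_; _≡ᵇ_; pred; z≤n; s≤s; s≤s⁻¹; _≟_; _<?_)
open import Data.Nat.Properties
  using (≤-refl; ≤-trans; n≤1+n; n<1+n; +-identityʳ; +-suc; +-comm; ≤∧≢⇒<; <⇒≢; ≤⇒≯; m≤n⇒m<n∨m≡n)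
open import Data.Bool using (Bool; true; false; not)
open import Data.List using (List; []; _∷_; [_]; length; _++_; _∷ʳ_; map; concat; concatMap)
open import Data.List.Properties using (length-++; map-++; concat-++; ++-identityʳ)
open import Data.List.Relation.Unary.All using (All; []; _∷_)
open import Data.List.Relation.Unary.All.Properties using (∷ʳ⁺; map⁺)
open import Data.Product using (_×_; _,_)
open import Data.Sum using (inj₁; inj₂)
open import Data.Maybe using (nothing)
open import Function using (_∘_)
open import Relation.Binary.PropositionalEquality
  using (_≡_; _≢_; refl; sym; trans; cong; cong₂; module ≡-Reasoning)
open import Relation.Nullary using (yes; no)
open import Relation.Nullary.Decidable using (dec-true; dec-false)

length-∷ʳ : ∀ {A : Set} (xs : List A) x → length (xs ∷ʳ x) ≡ suc (length xs)
length-∷ʳ xs x = trans (length-++ xs) (+-comm (length xs) 1)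

filterB-accept : ∀ {A : Set} {p : A → Bool} {x} xs → p x ≡ true →
                 filterB p (x ∷ xs) ≡ x ∷ filterB p xs
filterB-accept {p = p} {x} xs px with p x
... | true = refl

filterB-reject : ∀ {A : Set} {p : A → Bool} {x} xs → p x ≡ false →
                 filterB p (x ∷ xs) ≡ filterB p xs
filterB-reject {p = p} {x} xs px with p x
... | false = refl

filterB-cong : ∀ {A : Set} {p q : A → Bool} → (∀ x → p x ≡ q x) →
               ∀ xs → filterB p xs ≡ filterB q xs
filterB-cong p≗q []       = refl
filterB-cong {p = p} {q} p≗q (x ∷ xs) with p x | q x | p≗q x
... | true  | true  | refl = cong (x ∷_) (filterB-cong p≗q xs)
... | false | false | refl = filterB-cong p≗q xs

burgeRun-++ : ∀ T xs ys → burgeRun T (xs ++ ys) ≡ burgeRun (burgeRun T xs) ys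
burgeRun-++ T []       ys = refl
burgeRun-++ T (x ∷ xs) ys = burgeRun-++ (burgeStep T x) xs ys

tableauUpTo : ∀ {n} → SimpleGraph n → ℕ → Tableau
tableauUpTo G m = burgeRun [] (concatMap (columnsAt G) (oneTo m))

tableauUpTo-suc : ∀ {n} (G : SimpleGraph n) m →
  tableauUpTo G (suc m) ≡ burgeRun (tableauUpTo G m) (columnsAt G (suc m))
tableauUpTo-suc G m = begin
    burgeRun [] (concat (map cols (oneTo m ++ [ suc m ])))
  ≡⟨ cong (burgeRun [] ∘ concat) (map-++ cols (oneTo m) [ suc m ]) ⟩
    burgeRun [] (concat (map cols (oneTo m) ++ [ cols (suc m) ]))
  ≡⟨ cong (burgeRun []) (sym (concat-++ (map cols (oneTo m)) [ cols (suc m) ])) ⟩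
    burgeRun [] (concatMap cols (oneTo m) ++ cols (suc m) ++ [])
  ≡⟨ burgeRun-++ [] (concatMap cols (oneTo m)) (cols (suc m) ++ []) ⟩
    burgeRun (tableauUpTo G m) (cols (suc m) ++ [])
  ≡⟨ cong (burgeRun (tableauUpTo G m)) (++-identityʳ (cols (suc m))) ⟩
    burgeRun (tableauUpTo G m) (cols (suc m))
  ∎
  where
  open ≡-Reasoning
  cols : ℕ → List (ℕ × ℕ)
  cols = columnsAt G

starAdj-centre : ∀ i y → starAdj i i y ≡ not (y ≡ᵇ i)
starAdj-centre i y rewrite dec-true (i ≟ i) refl with y ≡ᵇ i
... | true  = refl
... | false = refl

starAdj-leaf : ∀ {i x} → x ≢ i → ∀ y → starAdj i x y ≡ (y ≡ᵇ i)
starAdj-leaf {i} {x} x≢i y rewrite dec-false (x ≟ i) x≢i with y ≡ᵇ i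
... | true  = refl
... | false = refl

filterB-≢ᵇ-downTo1 : ∀ {i} k → k < i → filterB (not ∘ (_≡ᵇ i)) (downTo1 k) ≡ downTo1 k
filterB-≢ᵇ-downTo1 zero    k<i = refl
filterB-≢ᵇ-downTo1 {i} (suc k) k<i =
  trans (filterB-accept (downTo1 k) (cong not (dec-false (suc k ≟ i) (<⇒≢ k<i))))
        (cong (suc k ∷_) (filterB-≢ᵇ-downTo1 k (≤-trans (n≤1+n _) k<i)))

filterB-≡ᵇ-downTo1-below : ∀ {i} k → k < i → filterB (_≡ᵇ i) (downTo1 k) ≡ []
filterB-≡ᵇ-downTo1-below zero    k<i = refl
filterB-≡ᵇ-downTo1-below {i} (suc k) k<i =
  trans (filterB-reject (downTo1 k) (dec-false (suc k ≟ i) (<⇒≢ k<i)))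
        (filterB-≡ᵇ-downTo1-below k (≤-trans (n≤1+n _) k<i))

filterB-≡ᵇ-downTo1 : ∀ {p} k → suc p ≤ k → filterB (_≡ᵇ suc p) (downTo1 k) ≡ [ suc p ]
filterB-≡ᵇ-downTo1 {p} (suc k) i≤1+k with suc k ≟ suc p
... | yes refl = trans (filterB-accept (downTo1 k) (dec-true (suc p ≟ suc p) refl))
                       (cong (suc p ∷_) (filterB-≡ᵇ-downTo1-below k ≤-refl))
... | no 1+k≢i = trans (filterB-reject (downTo1 k) (dec-false (suc k ≟ suc p) 1+k≢i))
                       (filterB-≡ᵇ-downTo1 k (s≤s⁻¹ (≤∧≢⇒< i≤1+k (1+k≢i ∘ sym))))

columnsAt-star-below : ∀ {n i} a → a < i → columnsAt (starGraph n i) a ≡ []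
columnsAt-star-below zero    a<i = refl
columnsAt-star-below {i = i} (suc k) a<i = cong (map (suc k ,_)) (begin
    filterB (starAdj i (suc k)) (downTo1 k)
  ≡⟨ filterB-cong (starAdj-leaf (<⇒≢ a<i)) (downTo1 k) ⟩
    filterB (_≡ᵇ i) (downTo1 k)
  ≡⟨ filterB-≡ᵇ-downTo1-below k (≤-trans (n≤1+n _) a<i) ⟩
    []
  ∎)
  where open ≡-Reasoning

columnsAt-star-centre : ∀ {n} p →
  columnsAt (starGraph n (suc p)) (suc p) ≡ map (suc p ,_) (downTo1 p)
columnsAt-star-centre p = cong (map (suc p ,_)) (begin
    filterB (starAdj (suc p) (suc p)) (downTo1 p)
  ≡⟨ filterB-cong (starAdj-centre (suc p)) (downTo1 p) ⟩
    filterB (not ∘ (_≡ᵇ suc p)) (downTo1 p)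
  ≡⟨ filterB-≢ᵇ-downTo1 p ≤-refl ⟩
    downTo1 p
  ∎)
  where open ≡-Reasoning

columnsAt-star-above : ∀ {n p} k → suc p < suc k →
  columnsAt (starGraph n (suc p)) (suc k) ≡ [ (suc k , suc p) ]
columnsAt-star-above {p = p} k i<a = cong (map (suc k ,_)) (begin
    filterB (starAdj (suc p) (suc k)) (downTo1 k)
  ≡⟨ filterB-cong (starAdj-leaf (<⇒≢ i<a ∘ sym)) (downTo1 k) ⟩
    filterB (_≡ᵇ suc p) (downTo1 k)
  ≡⟨ filterB-≡ᵇ-downTo1 k (s≤s⁻¹ i<a) ⟩
    [ suc p ]
  ∎)
  where open ≡-Reasoning

column : ℕ → ℕ → Tableau
column k zero    = []
column k (suc m) = [ k ] ∷ column (suc k) m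

length-column : ∀ k m → length (column k m) ≡ m
length-column k zero    = refl
length-column k (suc m) = cong suc (length-column (suc k) m)

column-singletons : ∀ k m → All (λ row → length row ≡ 1) (column k m)
column-singletons k zero    = []
column-singletons k (suc m) = refl ∷ column-singletons (suc k) m

insertRows-column : ∀ x m s → insertRows x (column (suc x) m) s ≡ (column x (suc m) , s + m , 1)
insertRows-column x zero    s rewrite +-identityʳ s = refl
insertRows-column x (suc m) s
  rewrite dec-true (x <? suc x) (n<1+n x) | insertRows-column (suc x) m (suc s) | +-suc s m
  = refl

burgeStep-column : ∀ a j r m →
  burgeStep ((suc j ∷ r) ∷ column (2 + j) m) (a , j) ≡ (j ∷ r ∷ʳ a) ∷ column (suc j) (suc m)
burgeStep-column a j r m
  rewrite dec-true (j <? suc j) (n<1+n j) | insertRows-column (suc j) m 2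
  = refl

data StarTableau (i : ℕ) : Tableau → Set where
  []   : StarTableau i []
  hook : ∀ {arm leg} → All (_≤ i) arm → length leg ≡ length arm →
         All (λ row → length row ≡ 1) leg → StarTableau i (arm ∷ leg)

burgeRun-column-star : ∀ {i} j r m → suc j ≤ i → All (_≤ i) r → m ≡ suc (length r) →
  StarTableau i (burgeRun ((suc j ∷ r) ∷ column (2 + j) m) (map (i ,_) (downTo1 j)))
burgeRun-column-star zero r m 1≤i r≤i m≡1+∣r∣ =
  hook (1≤i ∷ r≤i) (trans (length-column 2 m) m≡1+∣r∣) (column-singletons 2 m)
burgeRun-column-star {i} (suc j) r m 2+j≤i r≤i m≡1+∣r∣
  rewrite burgeStep-column i (suc j) r m =
  burgeRun-column-star j (r ∷ʳ i) (suc m) (≤-trans (n≤1+n _) 2+j≤i) (∷ʳ⁺ r≤i ≤-refl)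
    (cong suc (trans m≡1+∣r∣ (sym (length-∷ʳ r i))))

-- After the first insertion the tableau is [[p],[p+1]] = (p ∷ []) ∷ column (1 + p) 1.
burgeRun-centre-star : ∀ p → StarTableau (suc p) (burgeRun [] (map (suc p ,_) (downTo1 p)))
burgeRun-centre-star zero    = []
burgeRun-centre-star (suc q) = burgeRun-column-star q [] 1 (n≤1+n _) [] refl

bumpRow-max : ∀ x r → All (_≤ x) r → bumpRow x r ≡ (nothing , r ∷ʳ x)
bumpRow-max x []      []           = refl
bumpRow-max x (y ∷ r) (y≤x ∷ r≤x)
  rewrite dec-false (x <? y) (≤⇒≯ y≤x) | bumpRow-max x r r≤x = refl

placeInRow-end : ∀ a (rows : Tableau) L → length rows ≡ L →
  placeInRow a (suc L) rows ≡ rows ∷ʳ [ a ]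
placeInRow-end a []         zero    _   = refl
placeInRow-end a (row ∷ rows) (suc L) ∣rows∣≡L =
  cong (row ∷_) (placeInRow-end a rows L (cong pred ∣rows∣≡L))

burgeStep-star : ∀ {i T} a → StarTableau i T → StarTableau i (burgeStep T (a , i))
burgeStep-star a [] = hook (≤-refl ∷ []) refl (refl ∷ [])
burgeStep-star {i} a (hook {arm} {leg} arm≤i ∣leg∣≡∣arm∣ singletons)
  rewrite bumpRow-max i arm arm≤i | length-∷ʳ arm i
        | placeInRow-end a leg (length arm) ∣leg∣≡∣arm∣ =
  hook (∷ʳ⁺ arm≤i ≤-refl)
       (trans (length-∷ʳ leg [ a ])
              (trans (cong suc ∣leg∣≡∣arm∣) (sym (length-∷ʳ arm i))))
       (∷ʳ⁺ singletons refl)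

tableauUpTo-star-below : ∀ {n i} m → m < i → tableauUpTo (starGraph n i) m ≡ []
tableauUpTo-star-below zero    m<i = refl
tableauUpTo-star-below {n} {i} (suc m) m<i = begin
    tableauUpTo (starGraph n i) (suc m)
  ≡⟨ tableauUpTo-suc (starGraph n i) m ⟩
    burgeRun (tableauUpTo (starGraph n i) m) (columnsAt (starGraph n i) (suc m))
  ≡⟨ cong₂ burgeRun (tableauUpTo-star-below m (≤-trans (n≤1+n _) m<i))
                    (columnsAt-star-below {n} (suc m) m<i) ⟩
    []
  ∎
  where open ≡-Reasoning

tableauUpTo-star : ∀ {n} p m → suc p ≤ m →
  StarTableau (suc p) (tableauUpTo (starGraph n (suc p)) m)
tableauUpTo-star {n} p (suc m) i≤1+m rewrite tableauUpTo-suc (starGraph n (suc p)) m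
  with m≤n⇒m<n∨m≡n i≤1+m
... | inj₁ i<1+m rewrite columnsAt-star-above {n} m i<1+m =
  burgeStep-star (suc m) (tableauUpTo-star p m (s≤s⁻¹ i<1+m))
... | inj₂ refl rewrite tableauUpTo-star-below {n} p ≤-refl | columnsAt-star-centre {n} p =
  burgeRun-centre-star p

rowLen-≤1 : ∀ ls r → All (_≡ 1) ls → rowLen ls (suc r) ≤ 1
rowLen-≤1 []       r       _           = z≤n
rowLen-≤1 (l ∷ ls) zero    (refl ∷ _)  = ≤-refl
rowLen-≤1 (l ∷ ls) (suc r) (_ ∷ ls≡1) = rowLen-≤1 ls r ls≡1

isHook-∷-ones : ∀ l ls → All (_≡ 1) ls → IsHook (l ∷ ls)
isHook-∷-ones l ls ls≡1 (suc r) (suc c) (_ , _ , _ , (_ , _ , 2+c≤len))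
  with ≤-trans 2+c≤len (rowLen-≤1 ls r ls≡1)
... | s≤s ()

isHook-[] : IsHook []
isHook-[] r c (_ , _ , _ , (_ , _ , ()))

StarTableau⇒isHook : ∀ {i T} → StarTableau i T → IsHook (shapeOf T)
StarTableau⇒isHook []                       = isHook-[]
StarTableau⇒isHook (hook {arm} {leg} _ _ singletons) =
  isHook-∷-ones (length arm) (map length leg) (map⁺ singletons)

mainTheorem5 : (n i : ℕ) → 1 ≤ n → 1 ≤ i → i ≤ n → IsHookGraph (starGraph n i)
mainTheorem5 n zero    _ ()  _
mainTheorem5 n (suc p) _ _ i≤n = StarTableau⇒isHook (tableauUpTo-star p n i≤n)
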